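{- A marked permutation $\tau^{*}$ is insertable if and only if $\tau^*$ does not begin with a marked car and the unmarked permutation $\widehat{\tau}$ obtained by deleting the marked cars of $\tau^{*}$ has the same number of runs as $\tau^*$.
   Context: A marked permutation is a word of distinct positive integers ("cars") with some entries marked. A run of a word is a maximal contiguous increasing subword; runs of a marked permutation are those of the underlying word. Parking functions: a Dyck path of size $n$ goes from $(0,0)$ to $(n,n)$ with unit North/East steps weakly above $y=x$; a parking function is such a path with distinct positive cars, one in the cell immediately right of each North step, increasing upward in each column; the cell with lower-left corner $(i,j)$ lies in the $(j-i)$-diagonal; left/right refers to columns. A valley is an East step immediately followed by a North step such that the cell directly below the East step has no car or has a car smaller than the car next to that North step. A (valley-)marked parking function has a subset of valleys marked; the car next to a marked valley's North step is marked. Algorithm A, $\operatorname{Insert}(PF,c,k)$ (for $c\notin PF$, $(k+1)$-diagonal of $PF$ empty, $k$-diagonal containing no car smaller than $c$): the set of parking functions obtained by (1) for each car $s<c$ in the $(k-1)$-diagonal: move all cars in rows higher than $s$ up and right by one and place $c$ directly above $s$ (insert $NE$ after $s$'s North step, $c$ at the new North step); (2) for each car $b>c$ in the $k$-diagonal: move all cars in higher rows than $b$ up and right by one and place $c$ directly above and right of $b$ (insert $EN$ after $b$'s North step, $c$ at the new North step); (3) if $k=0$: move all cars up and right by one and put $c$ in the lower-left corner (prepend $NE$). Algorithm B, $\operatorname{Insert}^{*}(MPF,c,k)$ (for $c\notin MPF$, $k$-diagonal containing no marked car smaller than $c$): for each unmarked car $s<c$ in the $k$-diagonal and each unmarked car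 $b>c$ in the $(k+1)$-diagonal, look to the right of this car for the next time that either an unmarked car $b'>c$ appears in the $(k+1)$-diagonal or the path returns to the line $y=x+k$ (for $s$ with nothing directly above it, the latter happens immediately). In the first case shift $b'$ and every car in a higher row up and right by one and place a marked $c$ directly under $b'$; in the second case move all cars above this point up and right by one and place a marked $c$ in the cell directly right of and above this point (in the $k$-diagonal). The set of results is $\operatorname{Insert}^{*}(MPF,c,k)$. Insertion process for a marked permutation $\tau^*$ of length $n$: a car lying in the $(k+1)$-st run from the end of $\tau^*$ is inserted into the $k$-diagonal. Start with the set containing only the empty parking function. Process the unmarked cars of $\tau^*$ from right to left, replacing the current set $S$ by $\bigcup_{P\in S}\operatorname{Insert}(P,c,k)$; then process the marked cars from right to left, replacing $S$ by $\bigcup_{P\in S}\operatorname{Insert}^{*}(P,c,k)$ (an insertion whose hypotheses fail contributes nothing). $\tau^*$ is insertable if the final set (of marked parking functions of size $n$) is nonempty. -}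

module Defs where

open import Data.Nat using (ℕ; zero; suc; _∸_; _<ᵇ_; _≡ᵇ_; _≤ᵇ_; _<_)
open import Data.Bool using (Bool; true; false; if_then_else_; _∧_; _∨_; not)
open import Data.List using (List; []; _∷_; [_]; _++_; map; concatMap; length; foldr; filterᵇ)
open import Data.Bool.ListAction using (all; any)
open import Data.List.Relation.Unary.All using (All)
open import Data.List.Relation.Unary.Unique.Propositional using (Unique)
open import Data.Product using (_×_; _,_; proj₁; proj₂)

-- Marked permutations: words of cars (ℕ) with a mark (true = marked).

MarkedWord : Set
MarkedWord = List (ℕ × Bool)

cars : MarkedWord → List ℕ
cars = map proj₁

IsMarkedPerm : MarkedWord → Set
IsMarkedPerm τ = All (λ x → 0 < x) (cars τ) × Unique (cars τ)

unmarkedPart : MarkedWord → List ℕ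
unmarkedPart τ = map proj₁ (filterᵇ (λ p → not (proj₂ p)) τ)

BeginsMarked : MarkedWord → Bool
BeginsMarked []            = false
BeginsMarked ((_ , m) ∷ _) = m

runs : List ℕ → List (List ℕ)
runs []           = []
runs (x ∷ [])     = [ x ∷ [] ]
runs (x ∷ y ∷ xs) with runs (y ∷ xs)
... | []       = [ x ∷ [] ]
... | (r ∷ rs) = if x <ᵇ y then (x ∷ r) ∷ rs else (x ∷ []) ∷ r ∷ rs

numRuns : List ℕ → ℕ
numRuns w = length (runs w)

runIndexFromEnd : List (List ℕ) → ℕ → ℕ
runIndexFromEnd []       c = 0
runIndexFromEnd (r ∷ rs) c = if any (c ≡ᵇ_) r then length rs else runIndexFromEnd rs c

diagOf : MarkedWord → ℕ → ℕ
diagOf τ c = runIndexFromEnd (runs (cars τ)) c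

-- (Marked) parking functions, encoded row by row (bottom to top).
-- Row i (0-indexed) carries the car next to the i-th North step;
-- 'area' is the diagonal (i - x_i) of the cell containing that car,
-- where x_i is the column of the i-th North step.  A list of rows
-- encodes a Dyck path iff the first area is 0 and a_{i+1} ≤ a_i + 1;
-- rows i, i+1 are in the same column iff a_{i+1} = a_i + 1.
-- The North step of row j ≥ 1 is preceded by an East step iff
-- a_j ≤ a_{j-1}; the cell below that East step holds the car of row
-- j-1 iff a_j = a_{j-1}.

record Row : Set where
  constructor row
  field
    area   : ℕ
    car    : ℕ
    marked : Bool
open Row public

MPF : Set
MPF = List Row

emptyPF : MPF
emptyPF = []

isValley : Row → Row → Bool   -- previous row, current row
isValley p r = (area r <ᵇ area p) ∨ ((area r ≡ᵇ area p) ∧ (car p <ᵇ car r))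

validTail : Row → List Row → Bool
validTail p []       = true
validTail p (r ∷ rs) =
  (area r ≤ᵇ suc (area p))
  ∧ (if area r ≡ᵇ suc (area p) then car p <ᵇ car r else true)
  ∧ (if marked r then isValley p r else true)
  ∧ validTail r rs

isMarkedPF : MPF → Bool
isMarkedPF []       = true
isMarkedPF (r ∷ rs) = (area r ≡ᵇ 0) ∧ not (marked r) ∧ validTail r rs

carIn : ℕ → MPF → Bool
carIn c P = any (λ r → car r ≡ᵇ c) P

insertAfterEach : (Row → Bool) → Row → List Row → List (List Row)
insertAfterEach p new []       = []
insertAfterEach p new (r ∷ rs) =
  (if p r then [ r ∷ new ∷ rs ] else [])
  ++ map (r ∷_) (insertAfterEach p new rs)

insertA : MPF → ℕ → ℕ → List MPF
insertA P c k =
  if pre then step12 ++ step3 else []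
  where
    pre : Bool
    pre = not (carIn c P)
        ∧ all (λ r → not (area r ≡ᵇ suc k)) P
        ∧ all (λ r → if area r ≡ᵇ k then not (car r <ᵇ c) else true) P
    new : Row
    new = row k c false
    -- (1) s < c in the (k-1)-diagonal: c directly above s (NE after s)
    -- (2) b > c in the k-diagonal: c above and right of b (EN after b)
    -- both put c in row right after the chosen row, in diagonal k
    sel : Row → Bool
    sel r = ((suc (area r) ≡ᵇ k) ∧ (car r <ᵇ c)) ∨ ((area r ≡ᵇ k) ∧ (c <ᵇ car r))
    step12 : List MPF
    step12 = insertAfterEach sel new P
    -- (3) k = 0: prepend NE
    step3 : List MPF
    step3 = if k ≡ᵇ 0 then [ new ∷ P ] else []

-- scanning the rows after the chosen car: insert 'new' before the first
-- row that either has area ≤ k (the path has returned to y = x + k just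
-- before this row) or is an unmarked car b' > c in the (k+1)-diagonal
-- (place c directly under b'); if none, the path returns to y = x + k
-- after the last row.
scanB : ℕ → ℕ → Row → List Row → List Row
scanB c k new []       = new ∷ []
scanB c k new (r ∷ rs) =
  if (area r ≤ᵇ k) ∨ ((area r ≡ᵇ suc k) ∧ not (marked r) ∧ (c <ᵇ car r))
  then new ∷ r ∷ rs
  else r ∷ scanB c k new rs

startsB : ℕ → ℕ → Row → Bool
startsB c k r =
  not (marked r) ∧
  (((area r ≡ᵇ k) ∧ (car r <ᵇ c)) ∨ ((area r ≡ᵇ suc k) ∧ (c <ᵇ car r)))

insertBEach : ℕ → ℕ → List Row → List (List Row)
insertBEach c k []       = []
insertBEach c k (r ∷ rs) =
  (if startsB c k r then [ r ∷ scanB c k (row k c true) rs ] else [])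
  ++ map (r ∷_) (insertBEach c k rs)

insertB : MPF → ℕ → ℕ → List MPF
insertB P c k =
  if pre then insertBEach c k P else []
  where
    pre : Bool
    pre = not (carIn c P)
        ∧ all (λ r → if (area r ≡ᵇ k) ∧ marked r then not (car r <ᵇ c) else true) P

-- cars processed right to left: foldr processes the last element first
insertionProcess : MarkedWord → List MPF
insertionProcess τ =
  foldr (λ c S → concatMap (λ P → insertB P c (diagOf τ c)) S)
        (foldr (λ c S → concatMap (λ P → insertA P c (diagOf τ c)) S)
               [ emptyPF ]
               (unmarkedPart τ))
        markedCars
  where
    markedCars : List ℕ
    markedCars = map proj₁ (filterᵇ proj₂ τ)

Insertable : MarkedWord → Set
Insertable τ = ¬[] (insertionProcess τ)
  where
    open import Relation.Binary.PropositionalEquality using (_≢_)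
    ¬[] : List MPF → Set
    ¬[] S = S ≢ []

-- Every insertion step adds the row (diagonal, car, mark) of the new car to
-- every parking function it produces, and whether it produces anything
-- depends only on the rows already present.  Hence all parking functions of
-- a stage have the same rows, and insertability is the conjunction of the
-- insertion conditions, each evaluated on the rows of the cars to the right
-- of the inserted car (insertable⇔ok).
--
-- In a word without
-- repetitions every car stands Before the cars to its right: it lies in a
-- higher diagonal, or in the same run and is smaller (precedence).  Under
-- this order the unmarked phase succeeds iff every unmarked car is supported
-- by its right neighbour and the last one lies in the 0-diagonal (Grounded),
-- which by counting descents happens iff τ̂ has 1 + (diagonal of its first
-- car) runs (grounded⇔runs).  A leading marked car can never be supported
-- (markedFirst-notInsertable); after a leading unmarked car, a grounded
-- unmarked word supports every marked car (marked-supported), and the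
-- first car of τ* lies in the diagonal numRuns τ* - 1 (numRuns-head).

module Submission where

open import Defs
open import Data.Bool using (Bool; true; false; if_then_else_; _∧_; _∨_; not; T)
open import Data.Bool.Properties using (T-∧; T-∨; T-≡; T-not-≡; ∨-assoc; ∨-comm; ∧-identityʳ; ∧-zeroʳ)
open import Data.Bool.ListAction using (all; any)
open import Data.Empty using (⊥-elim)
open import Data.List using (List; []; _∷_; [_]; _++_; map; concatMap; foldr; filterᵇ)
open import Data.List.Membership.Propositional using (_∈_)
open import Data.List.Relation.Unary.All as All using (All; []; _∷_)
import Data.List.Relation.Unary.All.Properties as All
open import Data.List.Relation.Unary.AllPairs as AllPairs using (AllPairs; []; _∷_)
import Data.List.Relation.Unary.AllPairs.Properties as AllPairs
open import Data.List.Relation.Unary.Any as Any using (Any; here; there)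
import Data.List.Relation.Unary.Any.Properties as Any
open import Data.List.Relation.Unary.Linked using (Linked; [-]; _∷_)
open import Data.List.Relation.Unary.Unique.Propositional using (Unique)
open import Data.Nat using (ℕ; suc; _+_; _≤_; _<_; s≤s; _≡ᵇ_; _<ᵇ_; _≤ᵇ_)
open import Data.Nat.Properties
  using (≡ᵇ⇒≡; ≡⇒≡ᵇ; <ᵇ⇒<; <⇒<ᵇ; +-suc; +-assoc; +-identityʳ; +-cancelˡ-≡; +-cancelˡ-≤;
         +-monoʳ-≤; suc-injective; <-trans; <-asym; <-irrefl; <⇒≤; <⇒≱; ≮⇒≥; ≤∧≢⇒<; ≤-pred;
         ≤-refl; ≤-reflexive; ≤-antisym; n≤0⇒n≡0; n≮0; n<1+n; module ≤-Reasoning)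
open import Data.Product using (_×_; _,_; proj₁; proj₂; Σ)
open import Data.Product.Function.NonDependent.Propositional using (_×-⇔_)
open import Data.Sum using (_⊎_; inj₁; inj₂)
open import Data.Sum.Function.Propositional using (_⊎-⇔_)
open import Data.Unit using (⊤)
open import Function using (_∘_; _⇔_; mk⇔; Equivalence)
import Function.Properties.Equivalence as ⇔
open import Relation.Binary.PropositionalEquality hiding ([_])
open import Relation.Nullary using (¬_)
open import Relation.Nullary.Decidable using (T?)

-- nonemptiness of a list as a Boolean, so that it can be compared with
-- the Boolean insertion conditions
nonEmpty : {A : Set} → List A → Bool
nonEmpty []      = false
nonEmpty (_ ∷ _) = true

nonEmpty⇔ : {A : Set} {xs : List A} → T (nonEmpty xs) ⇔ (xs ≢ [])
nonEmpty⇔ {xs = []}    = mk⇔ (λ ()) (λ ne → ne refl)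
nonEmpty⇔ {xs = _ ∷ _} = mk⇔ (λ _ ()) (λ _ → _)

nonEmpty-++ : {A : Set} (xs ys : List A) → nonEmpty (xs ++ ys) ≡ nonEmpty xs ∨ nonEmpty ys
nonEmpty-++ []      ys = refl
nonEmpty-++ (_ ∷ _) ys = refl

nonEmpty-map : {A B : Set} (f : A → B) (xs : List A) → nonEmpty (map f xs) ≡ nonEmpty xs
nonEmpty-map f []      = refl
nonEmpty-map f (_ ∷ _) = refl

nonEmpty-if : {A : Set} (b : Bool) (xs : List A) → nonEmpty (if b then xs else []) ≡ b ∧ nonEmpty xs
nonEmpty-if true  xs = refl
nonEmpty-if false xs = refl

nonEmpty-concatMap : {A B : Set} (g : A → List B) (v : Bool) {xs : List A} →
  All (λ x → nonEmpty (g x) ≡ v) xs → nonEmpty (concatMap g xs) ≡ nonEmpty xs ∧ v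
nonEmpty-concatMap g v []                 = refl
nonEmpty-concatMap g v {x ∷ xs} (gx ∷ gxs) = begin
  nonEmpty (g x ++ concatMap g xs)           ≡⟨ nonEmpty-++ (g x) _ ⟩
  nonEmpty (g x) ∨ nonEmpty (concatMap g xs) ≡⟨ cong₂ _∨_ gx (nonEmpty-concatMap g v gxs) ⟩
  v ∨ (nonEmpty xs ∧ v)                      ≡⟨ absorb v (nonEmpty xs) ⟩
  v                                          ∎
  where
    open ≡-Reasoning
    absorb : ∀ v b → v ∨ (b ∧ v) ≡ v
    absorb true  b = refl
    absorb false b = ∧-zeroʳ b

All-if : {A : Set} {P : A → Set} (b : Bool) {xs : List A} → All P xs → All P (if b then xs else [])
All-if true  pxs = pxs
All-if false pxs = []

-- Rows of parking functions, compared as sets: P and L pass exactly the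
-- same Boolean tests.  The insertion conditions of both algorithms only
-- depend on the rows in this sense.
record SameRows (P L : List Row) : Set where
  constructor sameRows
  field anyEq : ∀ f → any f P ≡ any f L
open SameRows

sameRows-all : ∀ {P L} → SameRows P L → ∀ f → all f P ≡ all f L
sameRows-all {P} {L} same f = begin
  all f P                     ≡⟨ all-via-any P ⟩
  not (any (not ∘ f) P)       ≡⟨ cong not (anyEq same (not ∘ f)) ⟩
  not (any (not ∘ f) L)       ≡⟨ sym (all-via-any L) ⟩
  all f L                     ∎
  where
    open ≡-Reasoning
    all-via-any : ∀ xs → all f xs ≡ not (any (not ∘ f) xs)
    all-via-any []       = refl
    all-via-any (x ∷ xs) with f x
    ... | true  = all-via-any xs
    ... | false = refl

sameRows-∷ : ∀ {Q P L new} → SameRows Q (new ∷ P) → SameRows P L → SameRows Q (new ∷ L)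
sameRows-∷ {new = new} q p = sameRows λ f → trans (anyEq q f) (cong (f new ∨_) (anyEq p f))

sameRows-swap : ∀ {Q rs} r new → SameRows Q (new ∷ rs) → SameRows (r ∷ Q) (new ∷ r ∷ rs)
sameRows-swap {rs = rs} r new q =
  sameRows λ f → trans (cong (f r ∨_) (anyEq q f)) (swap (f r) (f new) (any f rs))
  where
    swap : ∀ a b c → a ∨ (b ∨ c) ≡ b ∨ (a ∨ c)
    swap a b c = trans (sym (∨-assoc a b c)) (trans (cong (_∨ c) (∨-comm a b)) (∨-assoc b a c))

-- The common shape of both algorithms: for every row r satisfying p,
-- keep the rows up to r and replace the rows after it by g of them.
insertAtEach : (Row → Bool) → (List Row → List Row) → List Row → List (List Row)
insertAtEach p g []       = []
insertAtEach p g (r ∷ rs) =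
  (if p r then [ r ∷ g rs ] else []) ++ map (r ∷_) (insertAtEach p g rs)

insertAfterEach-shape : ∀ p new P → insertAfterEach p new P ≡ insertAtEach p (new ∷_) P
insertAfterEach-shape p new []       = refl
insertAfterEach-shape p new (r ∷ rs) =
  cong (λ S → (if p r then [ r ∷ new ∷ rs ] else []) ++ map (r ∷_) S) (insertAfterEach-shape p new rs)

insertBEach-shape : ∀ c k P → insertBEach c k P ≡ insertAtEach (startsB c k) (scanB c k (row k c true)) P
insertBEach-shape c k []       = refl
insertBEach-shape c k (r ∷ rs) =
  cong (λ S → (if startsB c k r then [ r ∷ scanB c k (row k c true) rs ] else []) ++ map (r ∷_) S)
       (insertBEach-shape c k rs)

nonEmpty-insertAtEach : ∀ p g P → nonEmpty (insertAtEach p g P) ≡ any p P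
nonEmpty-insertAtEach p g []       = refl
nonEmpty-insertAtEach p g (r ∷ rs) =
  trans (nonEmpty-++ (if p r then [ r ∷ g rs ] else []) _)
        (cong₂ _∨_ (trans (nonEmpty-if (p r) _) (∧-identityʳ (p r)))
                   (trans (nonEmpty-map (r ∷_) _) (nonEmpty-insertAtEach p g rs)))

insertAtEach-rows : ∀ p g new → (∀ rs → SameRows (g rs) (new ∷ rs)) →
  ∀ P → All (λ Q → SameRows Q (new ∷ P)) (insertAtEach p g P)
insertAtEach-rows p g new g-rows []       = []
insertAtEach-rows p g new g-rows (r ∷ rs) =
  All.++⁺ (All-if (p r) (sameRows-swap r new (g-rows rs) ∷ []))
          (All.map⁺ (All.map (sameRows-swap r new) (insertAtEach-rows p g new g-rows rs)))

scanB-rows : ∀ c k new rs → SameRows (scanB c k new rs) (new ∷ rs)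
scanB-rows c k new []       = sameRows λ f → refl
scanB-rows c k new (r ∷ rs)
  with (area r ≤ᵇ k) ∨ ((area r ≡ᵇ suc k) ∧ not (marked r) ∧ (c <ᵇ car r))
... | true  = sameRows λ f → refl
... | false = sameRows-swap r new (scanB-rows c k new rs)

-- Algorithm A succeeds iff its guard holds and some car allows step (1)
-- or (2), or step (3) applies; the guard and the selector are those of
-- Defs.insertA.
preA : MPF → ℕ → ℕ → Bool
preA P c k = not (carIn c P)
           ∧ all (λ r → not (area r ≡ᵇ suc k)) P
           ∧ all (λ r → if area r ≡ᵇ k then not (car r <ᵇ c) else true) P

selA : ℕ → ℕ → Row → Bool
selA c k r = ((suc (area r) ≡ᵇ k) ∧ (car r <ᵇ c)) ∨ ((area r ≡ᵇ k) ∧ (c <ᵇ car r))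

canInsertA : MPF → ℕ → ℕ → Bool
canInsertA P c k = preA P c k ∧ (any (selA c k) P ∨ (k ≡ᵇ 0))

nonEmpty-insertA : ∀ P c k → nonEmpty (insertA P c k) ≡ canInsertA P c k
nonEmpty-insertA P c k = begin
  nonEmpty (insertA P c k)        ≡⟨ nonEmpty-if (preA P c k) (steps12 ++ step3) ⟩
  preA P c k ∧ nonEmpty (steps12 ++ step3)
                                  ≡⟨ cong (preA P c k ∧_) (nonEmpty-++ steps12 step3) ⟩
  preA P c k ∧ (nonEmpty steps12 ∨ nonEmpty step3)
                                  ≡⟨ cong (λ b → preA P c k ∧ (b ∨ nonEmpty step3)) nonEmpty-steps12 ⟩
  preA P c k ∧ (any (selA c k) P ∨ nonEmpty step3)
                                  ≡⟨ cong (λ b → preA P c k ∧ (any (selA c k) P ∨ b)) nonEmpty-step3 ⟩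
  canInsertA P c k                ∎
  where
    open ≡-Reasoning
    steps12 step3 : List MPF
    steps12 = insertAfterEach (selA c k) (row k c false) P
    step3   = if k ≡ᵇ 0 then [ row k c false ∷ P ] else []
    nonEmpty-steps12 : nonEmpty steps12 ≡ any (selA c k) P
    nonEmpty-steps12 = trans (cong nonEmpty (insertAfterEach-shape _ _ P)) (nonEmpty-insertAtEach _ _ P)
    nonEmpty-step3 : nonEmpty step3 ≡ (k ≡ᵇ 0)
    nonEmpty-step3 = trans (nonEmpty-if (k ≡ᵇ 0) _) (∧-identityʳ _)

insertA-rows : ∀ P c k → All (λ Q → SameRows Q (row k c false ∷ P)) (insertA P c k)
insertA-rows P c k =
  All-if (preA P c k)
    (All.++⁺ (subst (All _) (sym (insertAfterEach-shape _ _ P))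
                    (insertAtEach-rows _ _ _ (λ rs → sameRows λ f → refl) P))
             (All-if (k ≡ᵇ 0) (sameRows (λ f → refl) ∷ [])))

canInsertA-sameRows : ∀ {P L} → SameRows P L → ∀ c k → canInsertA P c k ≡ canInsertA L c k
canInsertA-sameRows same c k =
  cong₂ _∧_ (cong₂ (λ a b → not a ∧ b) (anyEq same _)
                   (cong₂ _∧_ (sameRows-all same _) (sameRows-all same _)))
            (cong (_∨ (k ≡ᵇ 0)) (anyEq same _))

preB : MPF → ℕ → ℕ → Bool
preB P c k = not (carIn c P)
           ∧ all (λ r → if (area r ≡ᵇ k) ∧ marked r then not (car r <ᵇ c) else true) P

canInsertB : MPF → ℕ → ℕ → Bool
canInsertB P c k = preB P c k ∧ any (startsB c k) P

nonEmpty-insertB : ∀ P c k → nonEmpty (insertB P c k) ≡ canInsertB P c k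
nonEmpty-insertB P c k =
  trans (nonEmpty-if (preB P c k) (insertBEach c k P))
        (cong (preB P c k ∧_) (trans (cong nonEmpty (insertBEach-shape c k P))
                                     (nonEmpty-insertAtEach _ _ P)))

insertB-rows : ∀ P c k → All (λ Q → SameRows Q (row k c true ∷ P)) (insertB P c k)
insertB-rows P c k =
  All-if (preB P c k) (subst (All _) (sym (insertBEach-shape c k P))
                             (insertAtEach-rows _ _ _ (scanB-rows c k _) P))

canInsertB-sameRows : ∀ {P L} → SameRows P L → ∀ c k → canInsertB P c k ≡ canInsertB L c k
canInsertB-sameRows same c k =
  cong₂ _∧_ (cong₂ (λ a b → not a ∧ b) (anyEq same _) (sameRows-all same _)) (anyEq same _)

Inserts : (MPF → List MPF) → Row → Bool → List Row → Set
Inserts ins new ok L =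
  ∀ {P} → SameRows P L → nonEmpty (ins P) ≡ ok × All (λ Q → SameRows Q (new ∷ L)) (ins P)

insertA-inserts : ∀ c k L → Inserts (λ P → insertA P c k) (row k c false) (canInsertA L c k) L
insertA-inserts c k L {P} same =
  trans (nonEmpty-insertA P c k) (canInsertA-sameRows same c k) ,
  All.map (λ q → sameRows-∷ q same) (insertA-rows P c k)

insertB-inserts : ∀ c k L → Inserts (λ P → insertB P c k) (row k c true) (canInsertB L c k) L
insertB-inserts c k L {P} same =
  trans (nonEmpty-insertB P c k) (canInsertB-sameRows same c k) ,
  All.map (λ q → sameRows-∷ q same) (insertB-rows P c k)

Stage : List Row → Bool → List MPF → Set
Stage L ok S = nonEmpty S ≡ ok × All (λ P → SameRows P L) S

stage-step : ∀ {ins new x L ok S} → Inserts ins new x L →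
  Stage L ok S → Stage (new ∷ L) (ok ∧ x) (concatMap ins S)
stage-step {ins} {x = x} spec (ne , rows) =
  trans (nonEmpty-concatMap ins x (All.map (λ s → proj₁ (spec s)) rows)) (cong (_∧ x) ne) ,
  All.concat⁺ (All.map⁺ (All.map (λ s → proj₂ (spec s)) rows))

unmarkedRow markedRow : (ℕ → ℕ) → ℕ → Row
unmarkedRow E c = row (E c) c false
markedRow   E c = row (E c) c true

unmarkedPhase : (ℕ → ℕ) → List ℕ → List MPF
unmarkedPhase E = foldr (λ c S → concatMap (λ P → insertA P c (E c)) S) [ emptyPF ]

markedPhase : (ℕ → ℕ) → List MPF → List ℕ → List MPF
markedPhase E S₀ = foldr (λ c S → concatMap (λ P → insertB P c (E c)) S) S₀

-- Success of the phases: every insertion condition holds at the moment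
-- the car is inserted, i.e. with respect to the cars to its right.
okA : (ℕ → ℕ) → List ℕ → Bool
okA E []       = true
okA E (c ∷ xs) = okA E xs ∧ canInsertA (map (unmarkedRow E) xs) c (E c)

rowsB : (ℕ → ℕ) → List ℕ → List ℕ → List Row
rowsB E ms us = map (markedRow E) ms ++ map (unmarkedRow E) us

okB : (ℕ → ℕ) → List ℕ → List ℕ → Bool
okB E us []       = okA E us
okB E us (c ∷ ms) = okB E us ms ∧ canInsertB (rowsB E ms us) c (E c)

unmarkedPhase-stage : ∀ E xs → Stage (map (unmarkedRow E) xs) (okA E xs) (unmarkedPhase E xs)
unmarkedPhase-stage E []       = refl , sameRows (λ f → refl) ∷ []
unmarkedPhase-stage E (c ∷ xs) = stage-step (insertA-inserts c (E c) _) (unmarkedPhase-stage E xs)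

markedPhase-stage : ∀ E us ms →
  Stage (rowsB E ms us) (okB E us ms)
        (markedPhase E (unmarkedPhase E us) ms)
markedPhase-stage E us []       = unmarkedPhase-stage E us
markedPhase-stage E us (c ∷ ms) = stage-step (insertB-inserts c (E c) _) (markedPhase-stage E us ms)

markedCars : MarkedWord → List ℕ
markedCars τ = map proj₁ (filterᵇ proj₂ τ)

insertable⇔ok : ∀ τ → Insertable τ ⇔ T (okB (diagOf τ) (unmarkedPart τ) (markedCars τ))
insertable⇔ok τ =
  mk⇔ (λ ins → subst T ne (Equivalence.from nonEmpty⇔ ins))
      (λ ok → Equivalence.to nonEmpty⇔ (subst T (sym ne) ok))
  where
    ne : nonEmpty (insertionProcess τ) ≡ okB (diagOf τ) (unmarkedPart τ) (markedCars τ)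
    ne = proj₁ (markedPhase-stage (diagOf τ) (unmarkedPart τ) (markedCars τ))

-- Diagonals from runs.  A car of w lying in the (k+1)-st run from the end
-- is inserted into the k-diagonal.
runDiag : List ℕ → ℕ → ℕ
runDiag w = runIndexFromEnd (runs w)

descent : ℕ → ℕ → ℕ
descent x y = if x <ᵇ y then 0 else 1

≡ᵇ-true : ∀ {m n} → m ≡ n → (m ≡ᵇ n) ≡ true
≡ᵇ-true {m} refl = Equivalence.to T-≡ (≡⇒≡ᵇ m m refl)

T-not : ∀ {b} → ¬ T b → T (not b)
T-not {false} _  = _
T-not {true}  ¬t = ¬t _

≡ᵇ-false : ∀ {m n} → m ≢ n → (m ≡ᵇ n) ≡ false
≡ᵇ-false {m} {n} m≢n = Equivalence.to T-not-≡ (T-not (m≢n ∘ ≡ᵇ⇒≡ m n))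

<ᵇ-true : ∀ {m n} → (m <ᵇ n) ≡ true → m < n
<ᵇ-true {m} {n} lt = <ᵇ⇒< m n (subst T (sym lt) _)

<ᵇ-false : ∀ {m n} → (m <ᵇ n) ≡ false → ¬ m < n
<ᵇ-false lt m<n = subst T lt (<⇒<ᵇ m<n)

runs-head : ∀ y xs → Σ (List ℕ) λ r → Σ (List (List ℕ)) λ rs → runs (y ∷ xs) ≡ (y ∷ r) ∷ rs
runs-head y []       = [] , [] , refl
runs-head y (z ∷ xs) with runs (z ∷ xs)
... | []     = [] , [] , refl
... | r ∷ rs with y <ᵇ z
...   | true  = r , rs , refl
...   | false = [] , r ∷ rs , refl

runs-cons : ∀ x y xs {r rs} → runs (y ∷ xs) ≡ (y ∷ r) ∷ rs →
  runs (x ∷ y ∷ xs) ≡ (if x <ᵇ y then (x ∷ y ∷ r) ∷ rs else [ x ] ∷ (y ∷ r) ∷ rs)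
runs-cons x y xs e rewrite e = refl

numRuns-cons : ∀ x y xs → numRuns (x ∷ y ∷ xs) ≡ descent x y + numRuns (y ∷ xs)
numRuns-cons x y xs with runs-head y xs
... | r , rs , e rewrite runs-cons x y xs e | e with x <ᵇ y
...   | true  = refl
...   | false = refl

runDiag-head : ∀ x y xs → runDiag (x ∷ y ∷ xs) x ≡ descent x y + runDiag (y ∷ xs) y
runDiag-head x y xs with runs-head y xs
... | r , rs , e rewrite runs-cons x y xs e | e with x <ᵇ y
...   | true  rewrite ≡ᵇ-true {x} refl | ≡ᵇ-true {y} refl = refl
...   | false rewrite ≡ᵇ-true {x} refl | ≡ᵇ-true {y} refl = refl

runDiag-tail : ∀ x ys c → c ≢ x → runDiag (x ∷ ys) c ≡ runDiag ys c
runDiag-tail x []       c c≢x rewrite ≡ᵇ-false c≢x = refl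
runDiag-tail x (y ∷ xs) c c≢x with runs-head y xs
... | r , rs , e rewrite runs-cons x y xs e | e with x <ᵇ y
...   | true  rewrite ≡ᵇ-false c≢x = refl
...   | false rewrite ≡ᵇ-false c≢x = refl

numRuns-head : ∀ x xs → numRuns (x ∷ xs) ≡ suc (runDiag (x ∷ xs) x)
numRuns-head x []       rewrite ≡ᵇ-true {x} refl = refl
numRuns-head x (y ∷ xs) = begin
  numRuns (x ∷ y ∷ xs)                    ≡⟨ numRuns-cons x y xs ⟩
  descent x y + numRuns (y ∷ xs)          ≡⟨ cong (descent x y +_) (numRuns-head y xs) ⟩
  descent x y + suc (runDiag (y ∷ xs) y)  ≡⟨ +-suc (descent x y) _ ⟩
  suc (descent x y + runDiag (y ∷ xs) y)  ≡⟨ cong suc (runDiag-head x y xs) ⟨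
  suc (runDiag (x ∷ y ∷ xs) x)            ∎
  where open ≡-Reasoning

module _ (E : ℕ → ℕ) where

  -- a may stand to the left of b in a word whose cars lie in the
  -- diagonals E: b lies in a lower diagonal, or in the same one with a < b
  Before : ℕ → ℕ → Set
  Before a b = E b < E a ⊎ (E a ≡ E b × a < b)

  Before-trans : ∀ {a b c} → Before a b → Before b c → Before a c
  Before-trans (inj₁ p)       (inj₁ q)        = inj₁ (<-trans q p)
  Before-trans (inj₁ p)       (inj₂ (e , _))  = inj₁ (subst (_< E _) e p)
  Before-trans (inj₂ (e , _)) (inj₁ q)        = inj₁ (subst (E _ <_) (sym e) q)
  Before-trans (inj₂ (e , p)) (inj₂ (e′ , q)) = inj₂ (trans e e′ , <-trans p q)

  Before⇒≢ : ∀ {a b} → Before a b → a ≢ b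
  Before⇒≢ (inj₁ p)       refl = <-irrefl refl p
  Before⇒≢ (inj₂ (_ , p)) refl = <-irrefl refl p

  Before⇒≤ : ∀ {a b} → Before a b → E b ≤ E a
  Before⇒≤ (inj₁ p)       = <⇒≤ p
  Before⇒≤ (inj₂ (e , _)) = ≤-reflexive (sym e)

  Before-sameDiag : ∀ {a b} → Before a b → E a ≡ E b → a < b
  Before-sameDiag (inj₁ p)       e = ⊥-elim (<-irrefl (sym e) p)
  Before-sameDiag (inj₂ (_ , p)) _ = p

  Before⇒≢suc : ∀ {a b} → Before a b → E b ≢ suc (E a)
  Before⇒≢suc {a} a-b e = <⇒≱ (subst (E a <_) (sym e) (n<1+n (E a))) (Before⇒≤ a-b)

  Before⇒≮ : ∀ {a b} → Before a b → E b ≡ E a → ¬ b < a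
  Before⇒≮ a-b e = <-asym (Before-sameDiag a-b (sym e))

  descent⇒Before : ∀ {a b} → a ≢ b → E a ≡ descent a b + E b → Before a b
  descent⇒Before {a} {b} a≢b e with a <ᵇ b in lt
  ... | true  = inj₂ (e , <ᵇ-true lt)
  ... | false = inj₁ (subst (E b <_) (sym e) (n<1+n (E b)))

precedence : ∀ w → Unique w → ∀ E → (∀ c → c ∈ w → E c ≡ runDiag w c) → AllPairs (Before E) w
precedence []          _           E agree = []
precedence (x ∷ [])    _           E agree = [] ∷ []
precedence (x ∷ y ∷ s) (x∉ ∷ uniq) E agree =
  (x-before-y ∷ All.map (Before-trans E x-before-y) (AllPairs.head tail-prec)) ∷ tail-prec
  where
    agree-tail : ∀ c → c ∈ y ∷ s → E c ≡ runDiag (y ∷ s) c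
    agree-tail c c∈ = trans (agree c (there c∈)) (runDiag-tail x (y ∷ s) c (λ c≡x → All.lookup x∉ c∈ (sym c≡x)))
    tail-prec : AllPairs (Before E) (y ∷ s)
    tail-prec = precedence (y ∷ s) uniq E agree-tail
    x-before-y : Before E x y
    x-before-y = descent⇒Before E (All.lookup x∉ (here refl)) (begin
      E x                              ≡⟨ agree x (here refl) ⟩
      runDiag (x ∷ y ∷ s) x            ≡⟨ runDiag-head x y s ⟩
      descent x y + runDiag (y ∷ s) y  ≡⟨ cong (descent x y +_) (agree-tail y (here refl)) ⟨
      descent x y + E y                ∎)
      where open ≡-Reasoning

squeeze : ∀ {a b c} → a ≤ b → b ≤ c → a ≡ c → a ≡ b × b ≡ c
squeeze {a} {b} {c} a≤b b≤c a≡c = trans a≡c (sym b≡c) , b≡c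
  where
    b≡c : b ≡ c
    b≡c = ≤-antisym b≤c (subst (_≤ _) a≡c a≤b)

m+n≤m⇒n≡0 : ∀ m n → m + n ≤ m → n ≡ 0
m+n≤m⇒n≡0 m n le = n≤0⇒n≡0 (+-cancelˡ-≤ m n 0 (subst (m + n ≤_) (sym (+-identityʳ m)) le))

module _ (E : ℕ → ℕ) where

  -- w allows Algorithm A to insert c into the diagonal E c: w is smaller
  -- and one diagonal lower (step 1), or larger and in the same diagonal (step 2)
  ASupport : ℕ → ℕ → Set
  ASupport c w = (suc (E w) ≡ E c × w < c) ⊎ (E w ≡ E c × c < w)

  -- the unmarked car v allows Algorithm B to insert the marked car c: v is
  -- smaller and in the same diagonal, or larger and one diagonal higher
  BSupport : ℕ → ℕ → Set
  BSupport c v = (E v ≡ E c × v < c) ⊎ (E v ≡ suc (E c) × c < v)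

  Supported : ℕ → List ℕ → Set
  Supported c xs = E c ≡ 0 ⊎ Any (ASupport c) xs

  EachSupported : List ℕ → Set
  EachSupported []       = ⊤
  EachSupported (c ∷ xs) = Supported c xs × EachSupported xs

  final : ℕ → List ℕ → ℕ
  final u []      = u
  final u (v ∷ l) = final v l

  Grounded : ℕ → List ℕ → Set
  Grounded u l = Linked ASupport (u ∷ l) × E (final u l) ≡ 0

  support-next : ∀ {c v w} → Before E c v → Before E v w → ASupport c w → ASupport c v
  support-next (inj₂ (e , c<v)) _         _                = inj₂ (sym e , c<v)
  support-next {v = v} (inj₁ v<c) v-w (inj₂ (e , _)) =
    ⊥-elim (<⇒≱ v<c (subst (_≤ E v) e (Before⇒≤ E v-w)))
  support-next {v = v} (inj₁ v<c) (inj₁ w<v) (inj₁ (e , _)) =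
    ⊥-elim (<⇒≱ w<v (≤-pred (subst (E v <_) (sym e) v<c)))
  support-next (inj₁ v<c) (inj₂ (e′ , v<w)) (inj₁ (e , w<c)) =
    inj₁ (trans (cong suc e′) e , <-trans v<w w<c)

  supported⇒next : ∀ {u v l} → Before E u v → All (Before E v) l → Supported u (v ∷ l) → ASupport u v
  supported⇒next {v = v} (inj₁ v<u) _   (inj₁ z)         = ⊥-elim (n≮0 (subst (E v <_) z v<u))
  supported⇒next (inj₂ (e , u<v))   _   (inj₁ _)         = inj₂ (sym e , u<v)
  supported⇒next _                  _   (inj₂ (here s))  = s
  supported⇒next u-v                v-l (inj₂ (there s)) =
    let v-w , s-w = All.lookupAny v-l s in support-next u-v v-w s-w

  eachSupported⇒grounded : ∀ u l → AllPairs (Before E) (u ∷ l) → EachSupported (u ∷ l) → Grounded u l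
  eachSupported⇒grounded u []      _                  (inj₁ z , _)         = [-] , z
  eachSupported⇒grounded u (v ∷ l) ((u-v ∷ _) ∷ prec) (supported , each) =
    supported⇒next u-v (AllPairs.head prec) supported ∷ proj₁ rest , proj₂ rest
    where
      rest : Grounded v l
      rest = eachSupported⇒grounded v l prec each

  grounded⇒eachSupported : ∀ u l → Grounded u l → EachSupported (u ∷ l)
  grounded⇒eachSupported u []      (_ , z)         = inj₁ z , _
  grounded⇒eachSupported u (v ∷ l) (s ∷ chain , z) =
    inj₂ (here s) , grounded⇒eachSupported v l (chain , z)

  descent-bound : ∀ {u v} → Before E u v → descent u v + E v ≤ E u
  descent-bound {u} {v} u-v with u <ᵇ v in lt | u-v
  ... | true  | _              = Before⇒≤ E u-v
  ... | false | inj₁ v<u       = v<u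
  ... | false | inj₂ (_ , u<v) = ⊥-elim (<ᵇ-false lt u<v)

  descent-tight : ∀ {u v} → ASupport u v → descent u v + E v ≡ E u
  descent-tight {u} {v} s with u <ᵇ v in lt | s
  ... | true  | inj₁ (_ , v<u) = ⊥-elim (<-asym v<u (<ᵇ-true lt))
  ... | true  | inj₂ (e , _)   = e
  ... | false | inj₁ (e , _)   = e
  ... | false | inj₂ (_ , u<v) = ⊥-elim (<ᵇ-false lt u<v)

  tight⇒support : ∀ {u v} → Before E u v → descent u v + E v ≡ E u → ASupport u v
  tight⇒support {u} {v} u-v e with u <ᵇ v in lt
  ... | true  = inj₂ (e , <ᵇ-true lt)
  ... | false = inj₁ (e , ≤∧≢⇒< (≮⇒≥ (<ᵇ-false lt)) (Before⇒≢ E u-v ∘ sym))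

  runs-telescope : ∀ u v l →
    numRuns (u ∷ v ∷ l) + E (final v l) ≡ descent u v + (numRuns (v ∷ l) + E (final v l))
  runs-telescope u v l =
    trans (cong (_+ E (final v l)) (numRuns-cons u v l)) (+-assoc (descent u v) _ _)

  runs-bound : ∀ u l → AllPairs (Before E) (u ∷ l) → numRuns (u ∷ l) + E (final u l) ≤ suc (E u)
  runs-bound u []      _                  = ≤-refl
  runs-bound u (v ∷ l) ((u-v ∷ _) ∷ prec) = begin
    numRuns (u ∷ v ∷ l) + E (final v l)           ≡⟨ runs-telescope u v l ⟩
    descent u v + (numRuns (v ∷ l) + E (final v l)) ≤⟨ +-monoʳ-≤ (descent u v) (runs-bound v l prec) ⟩
    descent u v + suc (E v)                       ≡⟨ +-suc (descent u v) (E v) ⟩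
    suc (descent u v + E v)                       ≤⟨ s≤s (descent-bound u-v) ⟩
    suc (E u)                                     ∎
    where open ≤-Reasoning

  chain⇒runs : ∀ u l → Linked ASupport (u ∷ l) → numRuns (u ∷ l) + E (final u l) ≡ suc (E u)
  chain⇒runs u []      _           = refl
  chain⇒runs u (v ∷ l) (s ∷ chain) = begin
    numRuns (u ∷ v ∷ l) + E (final v l)             ≡⟨ runs-telescope u v l ⟩
    descent u v + (numRuns (v ∷ l) + E (final v l)) ≡⟨ cong (descent u v +_) (chain⇒runs v l chain) ⟩
    descent u v + suc (E v)                         ≡⟨ +-suc (descent u v) (E v) ⟩
    suc (descent u v + E v)                         ≡⟨ cong suc (descent-tight s) ⟩
    suc (E u)                                       ∎
    where open ≡-Reasoning

  -- equality in runs-bound forces equality at every step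
  runs⇒chain : ∀ u l → AllPairs (Before E) (u ∷ l) →
    numRuns (u ∷ l) + E (final u l) ≡ suc (E u) → Linked ASupport (u ∷ l)
  runs⇒chain u []      _                  _  = [-]
  runs⇒chain u (v ∷ l) ((u-v ∷ _) ∷ prec) eq =
    tight⇒support u-v (suc-injective (trans (sym (+-suc d (E v))) step-tight))
      ∷ runs⇒chain v l prec (+-cancelˡ-≡ d _ _ rest-tight)
    where
      d : ℕ
      d = descent u v
      bounds : d + (numRuns (v ∷ l) + E (final v l)) ≡ d + suc (E v) × d + suc (E v) ≡ suc (E u)
      bounds = squeeze (+-monoʳ-≤ d (runs-bound v l prec))
                       (subst (_≤ suc (E u)) (sym (+-suc d (E v))) (s≤s (descent-bound u-v)))
                       (trans (sym (runs-telescope u v l)) eq)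
      rest-tight : d + (numRuns (v ∷ l) + E (final v l)) ≡ d + suc (E v)
      rest-tight = proj₁ bounds
      step-tight : d + suc (E v) ≡ suc (E u)
      step-tight = proj₂ bounds

  grounded⇔runs : ∀ u l → AllPairs (Before E) (u ∷ l) → Grounded u l ⇔ (numRuns (u ∷ l) ≡ suc (E u))
  grounded⇔runs u l prec = mk⇔ to from
    where
      to : Grounded u l → numRuns (u ∷ l) ≡ suc (E u)
      to (chain , z) = begin
        numRuns (u ∷ l)                     ≡⟨ +-identityʳ _ ⟨
        numRuns (u ∷ l) + 0                 ≡⟨ cong (numRuns (u ∷ l) +_) z ⟨
        numRuns (u ∷ l) + E (final u l)     ≡⟨ chain⇒runs u l chain ⟩
        suc (E u)                           ∎
        where open ≡-Reasoning
      from : numRuns (u ∷ l) ≡ suc (E u) → Grounded u l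
      from eq = runs⇒chain u l prec (trans (cong (numRuns (u ∷ l) +_) z) (trans (+-identityʳ _) eq)) , z
        where
          z : E (final u l) ≡ 0
          z = m+n≤m⇒n≡0 (numRuns (u ∷ l)) _ (subst (numRuns (u ∷ l) + E (final u l) ≤_) (sym eq) (runs-bound u l prec))

  Comparable : ℕ → ℕ → Set
  Comparable c v = Before E c v ⊎ Before E v c

  marked-between : ∀ {u v c} → Before E u c → ASupport u v → Before E c v → BSupport c u
  marked-between (inj₂ (e , u<c)) _                 _                 = inj₁ (e , u<c)
  marked-between {c = c} (inj₁ c<u) (inj₂ (e , _)) c-v =
    ⊥-elim (<⇒≱ c<u (subst (_≤ E c) e (Before⇒≤ E c-v)))
  marked-between {c = c} (inj₁ c<u) (inj₁ (e , _)) (inj₁ v<c) =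
    ⊥-elim (<⇒≱ v<c (≤-pred (subst (E c <_) (sym e) c<u)))
  marked-between (inj₁ c<u)       (inj₁ (e , v<u))  (inj₂ (e′ , c<v)) =
    inj₂ (trans (sym e) (cong suc (sym e′)) , <-trans c<v v<u)

  marked-supported : ∀ u l c → Grounded u l → Before E u c → All (Comparable c) l → Any (BSupport c) (u ∷ l)
  marked-supported u []      c (_ , z) (inj₁ c<u)       _ = ⊥-elim (n≮0 (subst (E c <_) z c<u))
  marked-supported u []      c (_ , z) (inj₂ (e , u<c)) _ = here (inj₁ (e , u<c))
  marked-supported u (v ∷ l) c (s ∷ chain , z) u-c (inj₂ v-c ∷ cmp) =
    there (marked-supported v l c (chain , z) v-c cmp)
  marked-supported u (v ∷ l) c (s ∷ chain , z) u-c (inj₁ c-v ∷ cmp) = here (marked-between u-c s c-v)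

  Before⇒¬BSupport : ∀ {c v} → Before E c v → ¬ BSupport c v
  Before⇒¬BSupport (inj₁ v<c)       (inj₁ (e , _))   = <-irrefl e v<c
  Before⇒¬BSupport (inj₂ (_ , c<v)) (inj₁ (_ , v<c)) = <-asym c<v v<c
  Before⇒¬BSupport c-v              (inj₂ (e , _))   = Before⇒≢suc E c-v e

T-both : ∀ {a b} → T a → T b → T (a ∧ b)
T-both ta tb = Equivalence.from T-∧ (ta , tb)

T-if : ∀ {b x} → (T b → T x) → T (if b then x else true)
T-if {true}  f = f _
T-if {false} f = _

T-none : {A : Set} (p : A → Bool) {xs : List A} → All (λ x → ¬ T (p x)) xs → T (not (any p xs))
T-none p {xs} none = T-not (λ t → All.All¬⇒¬Any none (Any.any⁻ p xs t))

T-compare : ∀ {a b m n a′ b′ m′ n′} →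
  T (((a ≡ᵇ b) ∧ (m <ᵇ n)) ∨ ((a′ ≡ᵇ b′) ∧ (m′ <ᵇ n′))) ⇔ ((a ≡ b × m < n) ⊎ (a′ ≡ b′ × m′ < n′))
T-compare = ⇔.trans T-∨ (⇔.trans T-∧ (T-≡ᵇ ×-⇔ T-<ᵇ) ⊎-⇔ ⇔.trans T-∧ (T-≡ᵇ ×-⇔ T-<ᵇ))
  where
    T-≡ᵇ : ∀ {m n} → T (m ≡ᵇ n) ⇔ (m ≡ n)
    T-≡ᵇ = mk⇔ (≡ᵇ⇒≡ _ _) (≡⇒≡ᵇ _ _)
    T-<ᵇ : ∀ {m n} → T (m <ᵇ n) ⇔ (m < n)
    T-<ᵇ = mk⇔ (<ᵇ⇒< _ _) <⇒<ᵇ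

T-any-map : {A : Set} {P : A → Set} (p : Row → Bool) (f : A → Row) {xs : List A} →
  (∀ {x} → T (p (f x)) ⇔ P x) → T (any p (map f xs)) ⇔ Any P xs
T-any-map p f {xs} p⇔P =
  mk⇔ (λ t → Any.map (Equivalence.to p⇔P) (Any.map⁻ (Any.any⁻ p (map f xs) t)))
      (λ a → Any.any⁺ p (Any.map⁺ (Any.map (Equivalence.from p⇔P) a)))

module _ (E : ℕ → ℕ) where

  preA-holds : ∀ c xs → All (Before E c) xs → T (preA (map (unmarkedRow E) xs) c (E c))
  preA-holds c xs c-xs = T-both fresh (T-both emptyAbove noSmaller)
    where
      fresh : T (not (carIn c (map (unmarkedRow E) xs)))
      fresh = T-none _ (All.map⁺ (All.map (λ c-v t → Before⇒≢ E c-v (sym (≡ᵇ⇒≡ _ _ t))) c-xs))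
      emptyAbove : T (all (λ r → not (area r ≡ᵇ suc (E c))) (map (unmarkedRow E) xs))
      emptyAbove = All.all⁻ _ (All.map⁺ (All.map (λ c-v → T-not (Before⇒≢suc E c-v ∘ ≡ᵇ⇒≡ _ _)) c-xs))
      noSmaller : T (all (λ r → if area r ≡ᵇ E c then not (car r <ᵇ c) else true) (map (unmarkedRow E) xs))
      noSmaller = All.all⁻ _ (All.map⁺ (All.map (λ c-v →
        T-if (λ t → T-not (Before⇒≮ E c-v (≡ᵇ⇒≡ _ _ t) ∘ <ᵇ⇒< _ _))) c-xs))

  canInsertA⇒ : ∀ c xs → T (canInsertA (map (unmarkedRow E) xs) c (E c)) → Supported E c xs
  canInsertA⇒ c xs t with Equivalence.to T-∨ (proj₂ (Equivalence.to T-∧ t))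
  ... | inj₁ s = inj₂ (Equivalence.to (T-any-map (selA c (E c)) (unmarkedRow E) T-compare) s)
  ... | inj₂ z = inj₁ (≡ᵇ⇒≡ _ 0 z)

  canInsertA⇐ : ∀ c xs → All (Before E c) xs → Supported E c xs →
    T (canInsertA (map (unmarkedRow E) xs) c (E c))
  canInsertA⇐ c xs c-xs s = T-both (preA-holds c xs c-xs) (Equivalence.from T-∨ (support s))
    where
      support : Supported E c xs → T (any (selA c (E c)) (map (unmarkedRow E) xs)) ⊎ T (E c ≡ᵇ 0)
      support (inj₁ z) = inj₂ (≡⇒≡ᵇ _ 0 z)
      support (inj₂ a) = inj₁ (Equivalence.from (T-any-map (selA c (E c)) (unmarkedRow E) T-compare) a)

  -- only unmarked rows start a scan of Algorithm B
  startsB-split : ∀ c ms us → T (any (startsB c (E c)) (rowsB E ms us)) ⇔ Any (BSupport E c) us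
  startsB-split c ms us = mk⇔ to from
    where
      to : T (any (startsB c (E c)) (rowsB E ms us)) → Any (BSupport E c) us
      to t with Any.++⁻ (map (markedRow E) ms) (Any.any⁻ _ (rowsB E ms us) t)
      ... | inj₁ marked   = ⊥-elim (All.All¬⇒¬Any (All.universal (λ _ ()) ms) (Any.map⁻ marked))
      ... | inj₂ unmarked = Any.map (Equivalence.to T-compare) (Any.map⁻ unmarked)
      from : Any (BSupport E c) us → T (any (startsB c (E c)) (rowsB E ms us))
      from a = Any.any⁺ _ (Any.++⁺ʳ (map (markedRow E) ms) (Any.map⁺ (Any.map (Equivalence.from T-compare) a)))

  preB-holds : ∀ c ms us → All (Before E c) ms → All (Comparable E c) us → T (preB (rowsB E ms us) c (E c))
  preB-holds c ms us c-ms c-us = T-both fresh noSmallerMarked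
    where
      ≢-comparable : ∀ {v} → Comparable E c v → v ≢ c
      ≢-comparable (inj₁ c-v) = Before⇒≢ E c-v ∘ sym
      ≢-comparable (inj₂ v-c) = Before⇒≢ E v-c
      fresh : T (not (carIn c (rowsB E ms us)))
      fresh = T-none _ (All.++⁺ (All.map⁺ (All.map (λ c-m t → Before⇒≢ E c-m (sym (≡ᵇ⇒≡ _ _ t))) c-ms))
                                (All.map⁺ (All.map (λ c-v t → ≢-comparable c-v (≡ᵇ⇒≡ _ _ t)) c-us)))
      noSmallerMarked : T (all (λ r → if (area r ≡ᵇ E c) ∧ marked r then not (car r <ᵇ c) else true)
                               (rowsB E ms us))
      noSmallerMarked = All.all⁻ _ (All.++⁺
        (All.map⁺ (All.map (λ c-m → T-if (λ t →
           T-not (Before⇒≮ E c-m (≡ᵇ⇒≡ _ _ (proj₁ (Equivalence.to T-∧ t))) ∘ <ᵇ⇒< _ _))) c-ms))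
        (All.map⁺ (All.universal (λ v → T-if {(E v ≡ᵇ E c) ∧ false} (⊥-elim ∘ proj₂ ∘ Equivalence.to T-∧)) us)))

  canInsertB⇒ : ∀ c ms us → T (canInsertB (rowsB E ms us) c (E c)) → Any (BSupport E c) us
  canInsertB⇒ c ms us t = Equivalence.to (startsB-split c ms us) (proj₂ (Equivalence.to T-∧ t))

  canInsertB⇐ : ∀ c ms us → All (Before E c) ms → All (Comparable E c) us → Any (BSupport E c) us →
    T (canInsertB (rowsB E ms us) c (E c))
  canInsertB⇐ c ms us c-ms c-us a =
    T-both (preB-holds c ms us c-ms c-us) (Equivalence.from (startsB-split c ms us) a)

  okA⇒ : ∀ xs → T (okA E xs) → EachSupported E xs
  okA⇒ []       _ = _
  okA⇒ (c ∷ xs) t = canInsertA⇒ c xs (proj₂ t′) , okA⇒ xs (proj₁ t′)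
    where
      t′ : T (okA E xs) × T (canInsertA (map (unmarkedRow E) xs) c (E c))
      t′ = Equivalence.to T-∧ t

  okA⇐ : ∀ xs → AllPairs (Before E) xs → EachSupported E xs → T (okA E xs)
  okA⇐ []       _             _          = _
  okA⇐ (c ∷ xs) (c-xs ∷ prec) (s , each) = T-both (okA⇐ xs prec each) (canInsertA⇐ c xs c-xs s)

  okB⇒ : ∀ us ms → T (okB E us ms) → T (okA E us) × All (λ c → Any (BSupport E c) us) ms
  okB⇒ us []       t = t , []
  okB⇒ us (c ∷ ms) t = proj₁ rest , canInsertB⇒ c ms us (proj₂ t′) ∷ proj₂ rest
    where
      t′ : T (okB E us ms) × T (canInsertB (rowsB E ms us) c (E c))
      t′ = Equivalence.to T-∧ t
      rest : T (okA E us) × All (λ c → Any (BSupport E c) us) ms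
      rest = okB⇒ us ms (proj₁ t′)

  okB⇐ : ∀ us ms → AllPairs (Before E) ms → All (λ c → All (Comparable E c) us) ms →
    T (okA E us) → All (λ c → Any (BSupport E c) us) ms → T (okB E us ms)
  okB⇐ us []       _             _             t _        = t
  okB⇐ us (c ∷ ms) (c-ms ∷ prec) (c-us ∷ cmps) t (s ∷ ss) =
    T-both (okB⇐ us ms prec cmps t ss) (canInsertB⇐ c ms us c-ms c-us s)

sub-All : ∀ {P : ℕ → Set} (p : ℕ × Bool → Bool) τ → All P (cars τ) → All P (map proj₁ (filterᵇ p τ))
sub-All p τ = All.map⁺ ∘ All.filter⁺ (T? ∘ p) ∘ All.map⁻

sub-AllPairs : ∀ {R : ℕ → ℕ → Set} (p : ℕ × Bool → Bool) τ →
  AllPairs R (cars τ) → AllPairs R (map proj₁ (filterᵇ p τ))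
sub-AllPairs p τ = AllPairs.map⁺ ∘ AllPairs.filter⁺ (T? ∘ p) ∘ AllPairs.map⁻

marked-vs-unmarked : ∀ {R : ℕ → ℕ → Set} τ → AllPairs R (cars τ) →
  All (λ c → All (λ v → R c v ⊎ R v c) (unmarkedPart τ)) (markedCars τ)
marked-vs-unmarked []               _              = []
marked-vs-unmarked ((x , true) ∷ τ)  (x-τ ∷ prec) =
  All.map inj₁ (sub-All (not ∘ proj₂) τ x-τ) ∷ marked-vs-unmarked τ prec
marked-vs-unmarked ((x , false) ∷ τ) (x-τ ∷ prec) =
  All.zipWith (λ (x-c , c-us) → inj₂ x-c ∷ c-us) (sub-All proj₂ τ x-τ , marked-vs-unmarked τ prec)

-- A leading marked car is Before every unmarked car, so Algorithm B finds
-- no car supporting it.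
markedFirst-notInsertable : ∀ h τ → Unique (cars ((h , true) ∷ τ)) → ¬ Insertable ((h , true) ∷ τ)
markedFirst-notInsertable h τ uniq ins =
  All.All¬⇒¬Any (All.map (Before⇒¬BSupport E) h-us)
    (All.head (proj₂ (okB⇒ E (unmarkedPart τ) (h ∷ markedCars τ) (Equivalence.to (insertable⇔ok τ₀) ins))))
  where
    τ₀ : MarkedWord
    τ₀ = (h , true) ∷ τ
    E : ℕ → ℕ
    E = diagOf τ₀
    h-us : All (Before E h) (unmarkedPart τ)
    h-us = sub-All (not ∘ proj₂) τ (AllPairs.head (precedence (cars τ₀) uniq E (λ _ _ → refl)))

-- With a leading unmarked car h, the unmarked phase succeeds iff the
-- unmarked word is grounded, i.e. has as many runs as τ; then every marked
-- car is supported automatically.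
unmarkedFirst-insertable : ∀ h τ → Unique (cars ((h , false) ∷ τ)) →
  Insertable ((h , false) ∷ τ) ⇔ (numRuns (h ∷ unmarkedPart τ) ≡ numRuns (h ∷ cars τ))
unmarkedFirst-insertable h τ uniq = mk⇔ to from
  where
    τ₀ : MarkedWord
    τ₀ = (h , false) ∷ τ
    E : ℕ → ℕ
    E = diagOf τ₀
    us ms : List ℕ
    us = unmarkedPart τ
    ms = markedCars τ
    prec : AllPairs (Before E) (h ∷ cars τ)
    prec = precedence (cars τ₀) uniq E (λ _ _ → refl)
    prec-us : AllPairs (Before E) (h ∷ us)
    prec-us = sub-AllPairs (not ∘ proj₂) τ₀ prec
    runs-τ : numRuns (h ∷ cars τ) ≡ suc (E h)
    runs-τ = numRuns-head h (cars τ)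
    grounded⇔ : Grounded E h us ⇔ (numRuns (h ∷ us) ≡ suc (E h))
    grounded⇔ = grounded⇔runs E h us prec-us

    to : Insertable τ₀ → numRuns (h ∷ us) ≡ numRuns (h ∷ cars τ)
    to ins = trans (Equivalence.to grounded⇔ (eachSupported⇒grounded E h us prec-us (okA⇒ E (h ∷ us) okA-us)))
                   (sym runs-τ)
      where
        okA-us : T (okA E (h ∷ us))
        okA-us = proj₁ (okB⇒ E (h ∷ us) ms (Equivalence.to (insertable⇔ok τ₀) ins))

    from : numRuns (h ∷ us) ≡ numRuns (h ∷ cars τ) → Insertable τ₀
    from eq = Equivalence.from (insertable⇔ok τ₀)
      (okB⇐ E (h ∷ us) ms (sub-AllPairs proj₂ τ₀ prec) cmps
            (okA⇐ E (h ∷ us) prec-us (grounded⇒eachSupported E h us grounded)) marked-ok)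
      where
        grounded : Grounded E h us
        grounded = Equivalence.from grounded⇔ (trans eq runs-τ)
        cmps : All (λ c → All (Comparable E c) (h ∷ us)) ms
        cmps = marked-vs-unmarked τ₀ prec
        marked-ok : All (λ c → Any (BSupport E c) (h ∷ us)) ms
        marked-ok = All.zipWith (λ { {c} (h-c , _ ∷ c-us) → marked-supported E h us c grounded h-c c-us })
                                (sub-All proj₂ τ (AllPairs.head prec) , cmps)

lemma3p15 : (τ : MarkedWord) → IsMarkedPerm τ →
    (Insertable τ ⇔ ((BeginsMarked τ ≡ false) × (numRuns (unmarkedPart τ) ≡ numRuns (cars τ))))
lemma3p15 []                _          = mk⇔ (λ _ → refl , refl) (λ _ ())
lemma3p15 ((h , true) ∷ τ)  (_ , uniq) = mk⇔ (⊥-elim ∘ markedFirst-notInsertable h τ uniq) (λ { (() , _) })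
lemma3p15 ((h , false) ∷ τ) (_ , uniq) = mk⇔ (λ ins → refl , to ins) (from ∘ proj₂)
  where open Equivalence (unmarkedFirst-insertable h τ uniq)
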